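{- $\mathbb{DP}\subsetneq\mathbb{RDP}\subsetneq\mathbb{WNM}$.
   Context: MTL-algebras are bounded, commutative, integral, prelinear residuated lattices $(A,*,\Rightarrow,\sqcap,\sqcup,0,1)$; $\sim x:=x\Rightarrow 0$. A drastic product chain is an MTL-chain in which $x*y=0$ whenever $x,y<1$ and $x*y=\min\{x,y\}$ otherwise; $\mathbb{DP}$ is the variety of MTL-algebras generated by all drastic product chains (equivalently, the subvariety of MTL-algebras satisfying $x\sqcup\sim(x*x)=1$). $\mathbb{WNM}$ is the subvariety of MTL-algebras satisfying $\sim(x*y)\sqcup((x\sqcap y)\Rightarrow(x*y))=1$, and $\mathbb{RDP}$ is the subvariety of $\mathbb{WNM}$ additionally satisfying $(x\Rightarrow\sim x)\sqcup\sim\sim x=1$. -}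

module Defs where

open import Level using (0ℓ)
open import Relation.Binary.PropositionalEquality using (_≡_)
open import Algebra.Core using (Op₂)
open import Data.Product using (_×_)
import Algebra.Structures as AS
import Algebra.Lattice.Structures as LS

record MTLAlgebra : Set₁ where
  infixl 7 _*_
  infixr 5 _⇒_
  infixl 6 _⊓_
  infixl 5 _⊔_
  field
    Carrier : Set
    _*_ _⇒_ _⊓_ _⊔_ : Op₂ Carrier
    𝟘 𝟙 : Carrier
    isLattice : LS.IsLattice _≡_ _⊔_ _⊓_
    isCommutativeMonoid : AS.IsCommutativeMonoid _≡_ _*_ 𝟙

  infix 4 _≤_
  _≤_ : Carrier → Carrier → Set
  x ≤ y = x ⊓ y ≡ x

  field
    -- bounded: 0 is the least, 1 the greatest element (integrality: 1 is
    -- simultaneously the monoid unit and the top)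
    𝟘-least : ∀ x → 𝟘 ≤ x
    𝟙-top   : ∀ x → x ≤ 𝟙
    residuation₁ : ∀ x y z → x * y ≤ z → x ≤ (y ⇒ z)
    residuation₂ : ∀ x y z → x ≤ (y ⇒ z) → x * y ≤ z
    prelinear : ∀ x y → (x ⇒ y) ⊔ (y ⇒ x) ≡ 𝟙

  ∼_ : Carrier → Carrier
  ∼ x = x ⇒ 𝟘



-- Membership in the varieties, via their defining equations.
-- DP: x ⊔ ∼(x*x) = 1   (equational characterization of the variety
-- generated by drastic product chains)
IsDP : MTLAlgebra → Set
IsDP A = ∀ x → x ⊔ (∼ (x * x)) ≡ 𝟙
  where open MTLAlgebra A

IsWNM : MTLAlgebra → Set
IsWNM A = ∀ x y → (∼ (x * y)) ⊔ ((x ⊓ y) ⇒ (x * y)) ≡ 𝟙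
  where open MTLAlgebra A

IsRDP : MTLAlgebra → Set
IsRDP A = IsWNM A × (∀ x → (x ⇒ (∼ x)) ⊔ (∼ (∼ x)) ≡ 𝟙)
  where open MTLAlgebra A

module Submission where

-- Every x in a DP-algebra satisfies x ⊔ ∼(x * x) = 1, and a ⊔ b = 1 lets one prove c ≤ t
-- separately under the "cases" a and b (from c * a ≤ t and c * b ≤ t). Under the cases x and
-- y the WNM term is 1 because x and y are below (x ⊓ y) ⇒ (x * y); in the remaining case
-- ∼(x * x) * ∼(y * y) ≤ ∼(x * y), by a further split along prelinearity. The RDP law follows
-- from ∼(x * x) ≤ x ⇒ ∼ x and x ≤ ∼ ∼ x. Both inclusions are strict: the four-element Gödel
-- chain is RDP, but x ⊔ ∼(x * x) = x for 0 < x < 1; the four-element nilpotent minimum chain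
-- 0 < a < b < 1 is WNM, but (b ⇒ ∼ b) ⊔ ∼ ∼ b = a ⊔ b = b.

open import Defs
open import Algebra.Bundles using (CommutativeMonoid)
open import Algebra.Core using (Op₂)
open import Algebra.Definitions using (Associative; Commutative; LeftIdentity; RightIdentity)
open import Algebra.Lattice.Bundles using (Lattice)
import Algebra.Lattice.Properties.Lattice as LatticeProperties
import Algebra.Lattice.Structures as LS
import Algebra.Solver.CommutativeMonoid as CommutativeMonoidSolver
import Algebra.Structures as AS
open import Data.Bool.Base using (if_then_else_)
open import Data.Fin.Base using (Fin; zero; suc; fromℕ; opposite)
open import Data.Fin.Properties using (_≟_; _≤?_; all?)
open import Data.Product using (_×_; ∃-syntax; _,_; proj₁)
open import Data.Vec.Base using ([]; _∷_)
open import Relation.Binary.PropositionalEquality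
import Relation.Binary.Lattice.Structures as Order
open import Relation.Nullary using (¬_; Dec; does; _×-dec_; _→-dec_)
open import Relation.Nullary.Decidable using (from-yes; from-no)

module MTLProperties (A : MTLAlgebra) where
  open MTLAlgebra A
  open AS.IsCommutativeMonoid isCommutativeMonoid
    using () renaming (assoc to *-assoc; comm to *-comm; identityˡ to *-identityˡ)

  private
    variable a b c t x y z : Carrier

    lattice : Lattice _ _
    lattice = record { isLattice = isLattice }

    -- the standard library orders a lattice by x ≡ x ⊓ y, the symmetric form of _≤_
    module O = Order.IsLattice (LatticeProperties.∨-∧-isOrderTheoreticLattice lattice)

  ≤-refl : x ≤ x
  ≤-refl = sym O.refl

  ≤-trans : x ≤ y → y ≤ z → x ≤ z
  ≤-trans p q = sym (O.trans (sym p) (sym q))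

  ≤-antisym : x ≤ y → y ≤ x → x ≡ y
  ≤-antisym p q = O.antisym (sym p) (sym q)

  x≤x⊔y : ∀ x y → x ≤ x ⊔ y
  x≤x⊔y x y = sym (O.x≤x∨y x y)

  y≤x⊔y : ∀ x y → y ≤ x ⊔ y
  y≤x⊔y x y = sym (O.y≤x∨y x y)

  ⊔-least : x ≤ z → y ≤ z → x ⊔ y ≤ z
  ⊔-least p q = sym (O.∨-least (sym p) (sym q))

  x⊓y≤x : ∀ x y → x ⊓ y ≤ x
  x⊓y≤x x y = sym (O.x∧y≤x x y)

  x⊓y≤y : ∀ x y → x ⊓ y ≤ y
  x⊓y≤y x y = sym (O.x∧y≤y x y)

  𝟙≤⇒≡𝟙 : 𝟙 ≤ x → x ≡ 𝟙
  𝟙≤⇒≡𝟙 p = ≤-antisym (𝟙-top _) p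

  modus-ponens : ∀ x y → (x ⇒ y) * x ≤ y
  modus-ponens x y = residuation₂ _ x y ≤-refl

  *-monoˡ-≤ : ∀ z → x ≤ y → x * z ≤ y * z
  *-monoˡ-≤ {y = y} z p = residuation₂ _ z _ (≤-trans p (residuation₁ y z _ ≤-refl))

  *-monoʳ-≤ : ∀ z → x ≤ y → z * x ≤ z * y
  *-monoʳ-≤ {x} {y} z p = subst₂ _≤_ (*-comm x z) (*-comm y z) (*-monoˡ-≤ z p)

  x*y≤y : ∀ x y → x * y ≤ y
  x*y≤y x y = subst (x * y ≤_) (*-identityˡ y) (*-monoˡ-≤ y (𝟙-top x))

  x*y≤x : ∀ x y → x * y ≤ x
  x*y≤x x y = subst (_≤ x) (*-comm y x) (x*y≤y y x)

  ≤-by-cases : a ⊔ b ≡ 𝟙 → c * a ≤ t → c * b ≤ t → c ≤ t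
  ≤-by-cases {a} {b} {c} {t} a⊔b≡𝟙 ca≤t cb≤t =
    subst (_≤ t) (*-identityˡ c)
      (residuation₂ 𝟙 c t (subst (_≤ c ⇒ t) a⊔b≡𝟙
        (⊔-least (residuation₁ a c t (subst (_≤ t) (*-comm c a) ca≤t))
                 (residuation₁ b c t (subst (_≤ t) (*-comm c b) cb≤t)))))

  ≡𝟙-by-cases : a ⊔ b ≡ 𝟙 → a ≤ t → b ≤ t → t ≡ 𝟙
  ≡𝟙-by-cases a⊔b≡𝟙 a≤t b≤t = 𝟙≤⇒≡𝟙 (subst (_≤ _) a⊔b≡𝟙 (⊔-least a≤t b≤t))

  ⇒-curry : ∀ x y z → (x * y) ⇒ z ≤ x ⇒ (y ⇒ z)
  ⇒-curry x y z = residuation₁ _ x _ (residuation₁ _ y z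
    (subst (_≤ z) (sym (*-assoc _ x y)) (modus-ponens (x * y) z)))

  x≤∼∼x : ∀ x → x ≤ ∼ ∼ x
  x≤∼∼x x = residuation₁ x (∼ x) 𝟘 (subst (_≤ 𝟘) (*-comm (∼ x) x) (modus-ponens x 𝟘))

  ∼[y*y]*⇒≤∼[x*y] : ∀ x y → ∼ (y * y) * (x ⇒ y) ≤ ∼ (x * y)
  ∼[y*y]*⇒≤∼[x*y] x y = residuation₁ _ (x * y) 𝟘
    (subst (_≤ 𝟘) (sym rearrange)
      (≤-trans (*-monoʳ-≤ (∼ (y * y)) (*-monoˡ-≤ y (modus-ponens x y))) (modus-ponens (y * y) 𝟘)))
    where
    monoid : CommutativeMonoid _ _
    monoid = record { isCommutativeMonoid = isCommutativeMonoid }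
    open CommutativeMonoidSolver monoid using (prove; var; _⊕_)
    rearrange : (∼ (y * y) * (x ⇒ y)) * (x * y) ≡ ∼ (y * y) * (((x ⇒ y) * x) * y)
    rearrange = prove 4 ((n ⊕ i) ⊕ (u ⊕ v)) (n ⊕ ((i ⊕ u) ⊕ v)) (∼ (y * y) ∷ (x ⇒ y) ∷ x ∷ y ∷ [])
      where n = var zero; i = var (suc zero); u = var (suc (suc zero)); v = var (suc (suc (suc zero)))

  ∼[x*x]*∼[y*y]≤∼[x*y] : ∀ x y → ∼ (x * x) * ∼ (y * y) ≤ ∼ (x * y)
  ∼[x*x]*∼[y*y]≤∼[x*y] x y = ≤-by-cases (prelinear x y)
    (≤-trans (*-monoˡ-≤ (x ⇒ y) (x*y≤y _ _)) (∼[y*y]*⇒≤∼[x*y] x y))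
    (≤-trans (*-monoˡ-≤ (y ⇒ x) (x*y≤x _ _))
      (subst (λ w → ∼ (x * x) * (y ⇒ x) ≤ ∼ w) (*-comm y x) (∼[y*y]*⇒≤∼[x*y] y x)))

  x≤x⊓y⇒x*y : ∀ x y → x ≤ (x ⊓ y) ⇒ (x * y)
  x≤x⊓y⇒x*y x y = residuation₁ x _ _ (*-monoʳ-≤ x (x⊓y≤y x y))

  y≤x⊓y⇒x*y : ∀ x y → y ≤ (x ⊓ y) ⇒ (x * y)
  y≤x⊓y⇒x*y x y = residuation₁ y _ _
    (subst (y * (x ⊓ y) ≤_) (*-comm y x) (*-monoʳ-≤ y (x⊓y≤x x y)))

  isDP⇒isWNM : IsDP A → IsWNM A
  isDP⇒isWNM dp x y = ≡𝟙-by-cases (dp x)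
    (≤-trans (x≤x⊓y⇒x*y x y) (y≤x⊔y _ _))
    (≤-by-cases (dp y)
      (≤-trans (x*y≤y _ y) (≤-trans (y≤x⊓y⇒x*y x y) (y≤x⊔y _ _)))
      (≤-trans (∼[x*x]*∼[y*y]≤∼[x*y] x y) (x≤x⊔y _ _)))

  isDP⇒isRDP : IsDP A → IsRDP A
  isDP⇒isRDP dp = isDP⇒isWNM dp , λ x → ≡𝟙-by-cases (dp x)
    (≤-trans (x≤∼∼x x) (y≤x⊔y _ _))
    (≤-trans (⇒-curry x x 𝟘) (x≤x⊔y _ _))

module FourElementChain where
  C : Set
  C = Fin 4

  ⊤ : C
  ⊤ = fromℕ 3

  infixl 6 _⊓_
  infixl 5 _⊔_
  _⊓_ _⊔_ : Op₂ C
  x ⊓ y = if does (x ≤? y) then x else y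
  x ⊔ y = if does (x ≤? y) then y else x

  infixl 7 _*ᴳ_ _*ᴺ_
  infixr 5 _⇒ᴳ_ _⇒ᴺ_
  _*ᴳ_ _⇒ᴳ_ : Op₂ C
  _*ᴳ_ = _⊓_
  x ⇒ᴳ y = if does (x ≤? y) then ⊤ else y

  -- the nilpotent minimum t-norm for the involution opposite x = 3 − x
  _*ᴺ_ _⇒ᴺ_ : Op₂ C
  x *ᴺ y = if does (x ≤? opposite y) then zero else x ⊓ y
  x ⇒ᴺ y = if does (x ≤? y) then ⊤ else opposite x ⊔ y

  ∀²? : {P : C → C → Set} → (∀ x y → Dec (P x y)) → Dec (∀ x y → P x y)
  ∀²? P? = all? λ x → all? (P? x)

  ∀³? : {P : C → C → C → Set} → (∀ x y z → Dec (P x y z)) → Dec (∀ x y z → P x y z)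
  ∀³? P? = all? λ x → ∀²? (P? x)

  ResiduatedChain : Op₂ C → Op₂ C → Set
  ResiduatedChain _*_ _⇒_ =
    Associative _≡_ _*_ × Commutative _≡_ _*_ × LeftIdentity _≡_ ⊤ _*_ × RightIdentity _≡_ ⊤ _*_
    × (∀ x y z → (x * y) ⊓ z ≡ x * y → x ⊓ (y ⇒ z) ≡ x)
    × (∀ x y z → x ⊓ (y ⇒ z) ≡ x → (x * y) ⊓ z ≡ x * y)
    × (∀ x y → (x ⇒ y) ⊔ (y ⇒ x) ≡ ⊤)

  residuatedChain? : (_*_ _⇒_ : Op₂ C) → Dec (ResiduatedChain _*_ _⇒_)
  residuatedChain? _*_ _⇒_ =
    ∀³? (λ x y z → (x * y) * z ≟ x * (y * z)) ×-dec ∀²? (λ x y → x * y ≟ y * x)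
    ×-dec all? (λ x → ⊤ * x ≟ x) ×-dec all? (λ x → x * ⊤ ≟ x)
    ×-dec ∀³? (λ x y z → ((x * y) ⊓ z ≟ x * y) →-dec (x ⊓ (y ⇒ z) ≟ x))
    ×-dec ∀³? (λ x y z → (x ⊓ (y ⇒ z) ≟ x) →-dec ((x * y) ⊓ z ≟ x * y))
    ×-dec ∀²? (λ x y → (x ⇒ y) ⊔ (y ⇒ x) ≟ ⊤)

  isLattice : LS.IsLattice _≡_ _⊔_ _⊓_
  isLattice = record
    { isEquivalence = isEquivalence
    ; ∨-comm = from-yes (∀²? λ x y → x ⊔ y ≟ y ⊔ x)
    ; ∨-assoc = from-yes (∀³? λ x y z → x ⊔ y ⊔ z ≟ x ⊔ (y ⊔ z))
    ; ∨-cong = cong₂ _⊔_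
    ; ∧-comm = from-yes (∀²? λ x y → x ⊓ y ≟ y ⊓ x)
    ; ∧-assoc = from-yes (∀³? λ x y z → x ⊓ y ⊓ z ≟ x ⊓ (y ⊓ z))
    ; ∧-cong = cong₂ _⊓_
    ; absorptive = from-yes (∀²? λ x y → x ⊔ x ⊓ y ≟ x) , from-yes (∀²? λ x y → x ⊓ (x ⊔ y) ≟ x)
    }

  chainAlgebra : (_*_ _⇒_ : Op₂ C) → ResiduatedChain _*_ _⇒_ → MTLAlgebra
  chainAlgebra _*_ _⇒_ (assoc , comm , idˡ , idʳ , res₁ , res₂ , prelinear) = record
    { Carrier = C ; _*_ = _*_ ; _⇒_ = _⇒_ ; _⊓_ = _⊓_ ; _⊔_ = _⊔_ ; 𝟘 = zero ; 𝟙 = ⊤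
    ; isLattice = isLattice
    ; isCommutativeMonoid = record
      { isMonoid = record
        { isSemigroup = record
          { isMagma = record { isEquivalence = isEquivalence ; ∙-cong = cong₂ _*_ }
          ; assoc = assoc }
        ; identity = idˡ , idʳ }
      ; comm = comm }
    ; 𝟘-least = from-yes (all? λ x → zero ⊓ x ≟ zero)
    ; 𝟙-top = from-yes (all? λ x → x ⊓ ⊤ ≟ x)
    ; residuation₁ = res₁
    ; residuation₂ = res₂
    ; prelinear = prelinear
    }

  module _ (_*_ _⇒_ : Op₂ C) (laws : ResiduatedChain _*_ _⇒_) where
    open MTLAlgebra (chainAlgebra _*_ _⇒_ laws) using (∼_)

    isDP? : Dec (IsDP (chainAlgebra _*_ _⇒_ laws))
    isDP? = all? λ x → x ⊔ ∼ (x * x) ≟ ⊤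

    isWNM? : Dec (IsWNM (chainAlgebra _*_ _⇒_ laws))
    isWNM? = ∀²? λ x y → ∼ (x * y) ⊔ ((x ⊓ y) ⇒ (x * y)) ≟ ⊤

    isRDP? : Dec (IsRDP (chainAlgebra _*_ _⇒_ laws))
    isRDP? = isWNM? ×-dec all? λ x → (x ⇒ (∼ x)) ⊔ (∼ (∼ x)) ≟ ⊤

  gödel-residuated : ResiduatedChain _*ᴳ_ _⇒ᴳ_
  gödel-residuated = from-yes (residuatedChain? _*ᴳ_ _⇒ᴳ_)

  nilpotentMinimum-residuated : ResiduatedChain _*ᴺ_ _⇒ᴺ_
  nilpotentMinimum-residuated = from-yes (residuatedChain? _*ᴺ_ _⇒ᴺ_)

  gödel nilpotentMinimum : MTLAlgebra
  gödel = chainAlgebra _*ᴳ_ _⇒ᴳ_ gödel-residuated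
  nilpotentMinimum = chainAlgebra _*ᴺ_ _⇒ᴺ_ nilpotentMinimum-residuated

  gödel-isRDP : IsRDP gödel
  gödel-isRDP = from-yes (isRDP? _*ᴳ_ _⇒ᴳ_ gödel-residuated)

  gödel-¬isDP : ¬ IsDP gödel
  gödel-¬isDP = from-no (isDP? _*ᴳ_ _⇒ᴳ_ gödel-residuated)

  nilpotentMinimum-isWNM : IsWNM nilpotentMinimum
  nilpotentMinimum-isWNM = from-yes (isWNM? _*ᴺ_ _⇒ᴺ_ nilpotentMinimum-residuated)

  nilpotentMinimum-¬isRDP : ¬ IsRDP nilpotentMinimum
  nilpotentMinimum-¬isRDP = from-no (isRDP? _*ᴺ_ _⇒ᴺ_ nilpotentMinimum-residuated)

open MTLProperties using (isDP⇒isRDP)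
open FourElementChain
  using (gödel; gödel-isRDP; gödel-¬isDP; nilpotentMinimum; nilpotentMinimum-isWNM; nilpotentMinimum-¬isRDP)

proposition3 : (((A : MTLAlgebra) → IsDP A → IsRDP A) × (∃[ A ] (IsRDP A × ¬ IsDP A)))
    × (((A : MTLAlgebra) → IsRDP A → IsWNM A) × (∃[ A ] (IsWNM A × ¬ IsRDP A)))
proposition3 =
  (isDP⇒isRDP , gödel , gödel-isRDP , gödel-¬isDP)
  , ((λ _ → proj₁) , nilpotentMinimum , nilpotentMinimum-isWNM , nilpotentMinimum-¬isRDP)
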